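{- Let $x\ge2$ and $y\ge 2$ be real numbers, and let $j=j(x,y)=\pi(\min(y,x/2))$. There exists a chain of integers of $\mathcal S(x,y)$ which begins at $2p_{j-1}$, ends at $2$, and contains every element of $\mathcal A(x/2,y)$.
   Context: A chain is a finite sequence of pairwise distinct positive integers such that for any two consecutive terms, the smaller divides the larger. $p_1<p_2<\cdots$ denotes the increasing sequence of primes, with the conventions $p_0=2$ and $p_{ -1}=1/2$; $\pi$ is the prime counting function. For an integer $n\ge 2$, $P(n)$ denotes its largest prime factor, and $P(1)=1$. $\mathcal S(x,y)=\{n\le x:P(n)\le y\}$. For $n\ge2$ written $n=q_1\cdots q_{\Omega(n)}$ with primes $q_1\ge\cdots\ge q_{\Omega(n)}$, $S(n)=\max_{1\le k\le\Omega(n)} q_1\cdots q_{k-1}q_k^2$, and $S(1)=1$. $\mathcal A(x,y)=\{n\ge1:P(n)\le y,\ S(n)\le x\}$. -}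

module Defs where

open import Data.Nat using (ℕ; zero; suc; _+_; _*_; _≤_; _<_; _≥_; _⊔_; _⊓_; _/_)
open import Data.Nat.Divisibility using (_∣_)
open import Data.Nat.Primality using (Prime; prime?)
open import Data.List using (List; []; _∷_; map; foldr; head; last)
open import Data.Nat.ListAction using (product)
open import Data.List.Relation.Unary.All using (All)
open import Data.List.Relation.Unary.Linked using (Linked)
open import Data.List.Relation.Unary.Unique.Propositional using (Unique)
open import Data.List.Membership.Propositional using (_∈_)
open import Data.Product using (_×_; ∃)
open import Data.Sum using (_⊎_)
open import Data.Maybe using (just)
open import Data.Bool using (true; false)
open import Relation.Nullary using (does)
open import Relation.Binary.PropositionalEquality using (_≡_)

primePi : ℕ → ℕ
primePi zero = 0
primePi (suc n) with does (prime? (suc n))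
... | true  = suc (primePi n)
... | false = primePi n

data LargestPrimeFactor (n : ℕ) : ℕ → Set where
  lpf-one   : n ≡ 1 → LargestPrimeFactor n 1
  lpf-prime : ∀ {q} → Prime q → q ∣ n → (∀ p → Prime p → p ∣ n → p ≤ q) →
              LargestPrimeFactor n q

-- for q₁ ≥ … ≥ q_m : the list [q₁…q_{k-1} q_k² | k = 1..m]
sTerms : List ℕ → List ℕ
sTerms []       = []
sTerms (q ∷ qs) = q * q ∷ map (q *_) (sTerms qs)

maximum : List ℕ → ℕ
maximum = foldr _⊔_ 0

data SValue (n : ℕ) : ℕ → Set where
  s-one  : n ≡ 1 → SValue n 1
  s-fact : (qs : List ℕ) → 2 ≤ n → All Prime qs → Linked _≥_ qs → product qs ≡ n →
           SValue n (maximum (sTerms qs))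

-- n ∈ 𝒮(x,y), where X = ⌊x⌋, Y = ⌊y⌋ (n a positive integer)
InS : ℕ → ℕ → ℕ → Set
InS X Y n = 1 ≤ n × n ≤ X × ∃ λ q → LargestPrimeFactor n q × q ≤ Y

-- n ∈ 𝒜(x/2,y), where X = ⌊x⌋, Y = ⌊y⌋ ; S(n) ≤ x/2 ⇔ 2·S(n) ≤ ⌊x⌋
InA : ℕ → ℕ → ℕ → Set
InA X Y n = 1 ≤ n × (∃ λ q → LargestPrimeFactor n q × q ≤ Y) × (∃ λ s → SValue n s × 2 * s ≤ X)

Step : ℕ → ℕ → Set
Step a b = (a < b → a ∣ b) × (b < a → b ∣ a)

Chain : List ℕ → Set
Chain c = Unique c × All (1 ≤_) c × Linked Step c

-- StartValue j b  :  b = 2 p_{j-1}, with p_{-1} = 1/2, p_0 = 2, p_1 = 2 < p_2 = 3 < …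
data StartValue : ℕ → ℕ → Set where
  start-zero : StartValue 0 1
  start-one  : StartValue 1 4
  start-more : ∀ {k q} → Prime q → primePi q ≡ suc k → StartValue (suc (suc k)) (2 * q)

-- j(x,y) = π(min(y, x/2)) = π(min(⌊y⌋, ⌊⌊x⌋/2⌋))
jIndex : ℕ → ℕ → ℕ
jIndex X Y = primePi (Y ⊓ (X / 2))

-- Besides 1 and 2, an n ∈ 𝒜(x/2, y) is either a power of 2 or n = p m with
-- p = P(n) ≥ 3 "admissible" (2p² ≤ x, p ≤ y) and m ∈ 𝒜(x/(2p), p).  Multiplying the chain given by
-- induction for (x/p, p), which runs from 2q to 2 with q the prime preceding p, by p yields a segment from
-- 2pq to 2p through all n with P(n) = p.  Since 2q divides 2pq, the segments of consecutive admissible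
-- primes link up, the first one (p = 3, starting at 12) after the powers of 2 ending at 4; this ladder
-- climbs to 2g for the largest admissible prime g.  Read backwards, followed by 1 (linked to everything)
-- and 2, it is almost the required chain; to start exactly at 2p_{j-1}, the segment of p_j is moved
-- behind 1 when p_j is admissible, and 2p_{j-1} is put in front of 1 when p_{j-1} is not.

module Submission where

open import Defs
open import Data.Nat
open import Data.Nat.Properties
open import Data.Nat.Divisibility
open import Data.Nat.DivMod using (m*n/n≡m; /-monoˡ-≤; m/n*n≤m; m/n<m; m<n*o⇒m/o<n)
open import Data.Nat.Primality
  using ( Prime; prime?; prime[2]; prime⇒nonZero; prime⇒nonTrivial; prime⇒irreducible; euclidsLemma
        ; productOfPrimes≥1)
open import Data.Nat.Induction using (<-rec)
open import Data.Nat.ListAction using (product)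
open import Data.List using (List; []; _∷_; _++_; [_]; map; head; last; length; reverse; applyDownFrom; _ʳ++_)
open import Data.List.Properties using (head-map; last-map)
open import Data.List.Relation.Unary.All as All using (All; []; _∷_)
import Data.List.Relation.Unary.All.Properties as Allₚ
import Data.List.Relation.Unary.Any.Properties as Anyₚ
open import Data.List.Relation.Unary.Any using (here; there)
open import Data.List.Relation.Unary.Linked as Linked using (Linked; []; [-]; _∷_)
import Data.List.Relation.Unary.Linked.Properties as Linkedₚ
open import Data.List.Relation.Unary.Unique.Propositional using ([]; _∷_)
import Data.List.Relation.Unary.Unique.Propositional.Properties as Uniqueₚ
open import Data.List.Relation.Binary.Disjoint.Propositional using (Disjoint)
open import Data.List.Relation.Binary.Permutation.Propositional using (↭-sym; ↭⇒↭ₛ)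
open import Data.List.Relation.Binary.Permutation.Propositional.Properties
  using (↭-reverse; All-resp-↭; ∈-resp-↭)
open import Data.List.Relation.Binary.Permutation.Setoid.Properties using (Unique-resp-↭)
open import Data.List.Membership.Propositional using (_∈_; _∉_)
open import Data.List.Membership.Propositional.Properties using (∈-++⁺ˡ; ∈-++⁺ʳ; ∈-++⁻; ∈-map⁺)
open import Data.Maybe using (just)
open import Data.Maybe.Relation.Unary.All as Maybe using (just; nothing)
open import Data.Maybe.Relation.Binary.Connected using (Connected; just; just-nothing; nothing-just)
open import Data.Empty using (⊥)
open import Data.Sum using (_⊎_; inj₁; inj₂)
open import Data.Product using (∃; _×_; _,_; proj₁; proj₂)
open import Relation.Nullary using (¬_; Dec; yes; no; contradiction)
open import Relation.Nullary.Decidable using (_×-dec_)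
open import Relation.Binary.Definitions using (Symmetric)
open import Relation.Binary.PropositionalEquality hiding ([_])

≤⇒≡∨≤∸1 : ∀ {m n} → m ≤ n → m ≡ n ⊎ m ≤ n ∸ 1
≤⇒≡∨≤∸1 {n = zero} z≤n = inj₁ refl
≤⇒≡∨≤∸1 {n = suc n} m≤1+n with m≤n⇒m<n∨m≡n m≤1+n
... | inj₁ m<1+n = inj₂ (s≤s⁻¹ m<1+n)
... | inj₂ m≡1+n = inj₁ m≡1+n

*-swapˡ : ∀ m n o → m * (n * o) ≡ n * (m * o)
*-swapˡ m n o = trans (sym (*-assoc m n o)) (trans (cong (_* o) (*-comm m n)) (*-assoc n m o))

*≤⇒≤/ : ∀ m n o .{{_ : NonZero m}} → m * n ≤ o → n ≤ o / m
*≤⇒≤/ m n o mn≤o = subst (_≤ o / m) (m*n/n≡m n m) (/-monoˡ-≤ m (subst (_≤ o) (*-comm m n) mn≤o))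

*/≤ : ∀ m n .{{_ : NonZero m}} → m * (n / m) ≤ n
*/≤ m n = subst (_≤ n) (*-comm (n / m) m) (m/n*n≤m n m)

2^-bracket : ∀ n → 1 ≤ n → ∃ λ e → 2 ^ e ≤ n × n < 2 ^ suc e
2^-bracket (suc zero) _ = 0 , ≤-refl , s≤s (s≤s z≤n)
2^-bracket (suc (suc n)) _ with 2^-bracket (suc n) (s≤s z≤n)
... | e , 2^e≤1+n , 1+n<2^1+e with m≤n⇒m<n∨m≡n 1+n<2^1+e
...   | inj₁ 2+n<2^1+e = e , m≤n⇒m≤1+n 2^e≤1+n , 2+n<2^1+e
...   | inj₂ 2+n≡2^1+e = suc e , ≤-reflexive (sym 2+n≡2^1+e) ,
          subst (_< 2 ^ suc (suc e)) (sym 2+n≡2^1+e) (^-monoʳ-< 2 (s≤s (s≤s z≤n)) (n<1+n (suc e)))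

-- Primes and the prime counting function

prime⇒≥2 : ∀ {p} → Prime p → 2 ≤ p
prime⇒≥2 {p} pp = nonTrivial⇒n>1 p {{prime⇒nonTrivial pp}}

prime∤1 : ∀ {p} → Prime p → ¬ p ∣ 1
prime∤1 pp p∣1 = <⇒≢ (prime⇒≥2 pp) (sym (∣1⇒≡1 p∣1))

prime∣prime⇒≡ : ∀ {p q} → Prime p → Prime q → p ∣ q → p ≡ q
prime∣prime⇒≡ pp pq p∣q with prime⇒irreducible pq p∣q
... | inj₁ refl = contradiction (prime⇒≥2 pp) 1+n≰n
... | inj₂ p≡q = p≡q

primePi-suc-prime : ∀ {n} → Prime (suc n) → primePi (suc n) ≡ suc (primePi n)
primePi-suc-prime {n} p with prime? (suc n)
... | yes _ = refl
... | no ¬p = contradiction p ¬p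

primePi-suc-¬prime : ∀ {n} → ¬ Prime (suc n) → primePi (suc n) ≡ primePi n
primePi-suc-¬prime {n} ¬p with prime? (suc n)
... | yes p = contradiction p ¬p
... | no _ = refl

primePi-prime : ∀ {p} → Prime p → primePi p ≡ suc (primePi (p ∸ 1))
primePi-prime {zero} pp = contradiction (prime⇒≥2 pp) λ ()
primePi-prime {suc p} pp = primePi-suc-prime pp

primePi-≤-suc : ∀ n → primePi n ≤ primePi (suc n)
primePi-≤-suc n with prime? (suc n)
... | yes _ = n≤1+n _
... | no _ = ≤-refl

primePi-mono : ∀ {m n} → m ≤ n → primePi m ≤ primePi n
primePi-mono {n = zero} z≤n = ≤-refl
primePi-mono {n = suc n} m≤1+n with ≤⇒≡∨≤∸1 m≤1+n
... | inj₁ refl = ≤-refl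
... | inj₂ m≤n = ≤-trans (primePi-mono m≤n) (primePi-≤-suc n)

primePi-<-prime : ∀ {n q} → Prime q → n < q → primePi n < primePi q
primePi-<-prime {q = suc q} pq (s≤s n≤q) rewrite primePi-suc-prime pq = s≤s (primePi-mono n≤q)

GreatestPrime≤ : ℕ → ℕ → Set
GreatestPrime≤ n q = Prime q × q ≤ n × (∀ p → Prime p → p ≤ n → p ≤ q)

greatestPrime≤-unique : ∀ {n q q′} → GreatestPrime≤ n q → GreatestPrime≤ n q′ → q ≡ q′
greatestPrime≤-unique (pq , q≤n , max) (pq′ , q′≤n , max′) =
  ≤-antisym (max′ _ pq q≤n) (max _ pq′ q′≤n)

primePi⇒greatestPrime≤ : ∀ {n q} → Prime q → primePi q ≡ primePi n → GreatestPrime≤ n q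
primePi⇒greatestPrime≤ {n} {q} pq πq≡πn = pq , q≤n , greatest
  where
  q≤n : q ≤ n
  q≤n = ≮⇒≥ λ n<q → <⇒≢ (primePi-<-prime pq n<q) (sym πq≡πn)
  greatest : ∀ p → Prime p → p ≤ n → p ≤ q
  greatest p pp p≤n = ≮⇒≥ λ q<p →
    <⇒≱ (primePi-<-prime pp q<p) (subst (primePi p ≤_) (sym πq≡πn) (primePi-mono p≤n))

primeWithSamePrimePi : ∀ {n} → 2 ≤ n → ∃ λ q → Prime q × primePi q ≡ primePi n
primeWithSamePrimePi {suc zero} (s≤s ())
primeWithSamePrimePi {suc (suc zero)} _ = 2 , prime[2] , refl
primeWithSamePrimePi {suc (suc (suc n))} _ with prime? (suc (suc (suc n)))
  | primeWithSamePrimePi {suc (suc n)} (s≤s (s≤s z≤n))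
... | yes p | _ = _ , p , refl
... | no ¬p | q , pq , e = q , pq , trans e (sym (primePi-suc-¬prime ¬p))

greatestPrime≤-exists : ∀ {n} → 2 ≤ n → ∃ (GreatestPrime≤ n)
greatestPrime≤-exists 2≤n = let q , pq , e = primeWithSamePrimePi 2≤n in q , primePi⇒greatestPrime≤ pq e

greatestPrime≤⇒primePi : ∀ {n q} → GreatestPrime≤ n q → primePi q ≡ primePi n
greatestPrime≤⇒primePi g@(pq , q≤n , _) =
  let q′ , pq′ , e = primeWithSamePrimePi (≤-trans (prime⇒≥2 pq) q≤n)
  in trans (cong primePi (greatestPrime≤-unique g (primePi⇒greatestPrime≤ pq′ e))) e

greatestPrime≤⇒startValue : ∀ {n q} → GreatestPrime≤ n q → StartValue (suc (primePi n)) (2 * q)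
greatestPrime≤⇒startValue {n} {q} g@(pq , _) with primePi q in e | primePi-mono (prime⇒≥2 pq)
... | suc k | _ =
  subst (λ j → StartValue (suc j) (2 * q)) (trans (sym e) (greatestPrime≤⇒primePi g)) (start-more pq e)

startValue⇒greatestPrime≤ : ∀ {n b} → 2 ≤ n → StartValue (suc (primePi n)) b →
  ∃ λ q → b ≡ 2 * q × GreatestPrime≤ n q
startValue⇒greatestPrime≤ {n} 2≤n sv with primePi n in e | primePi-mono 2≤n
startValue⇒greatestPrime≤ 2≤n (start-more pq πq≡1+k) | suc k | _ =
  _ , refl , primePi⇒greatestPrime≤ pq (trans πq≡1+k (sym e))

-- Largest prime factors and the function S

lpf-unique : ∀ {n a b} → LargestPrimeFactor n a → LargestPrimeFactor n b → a ≡ b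
lpf-unique (lpf-one _) (lpf-one _) = refl
lpf-unique (lpf-one refl) (lpf-prime pb b∣1 _) = contradiction b∣1 (prime∤1 pb)
lpf-unique (lpf-prime pa a∣1 _) (lpf-one refl) = contradiction a∣1 (prime∤1 pa)
lpf-unique (lpf-prime pa a∣n maxa) (lpf-prime pb b∣n maxb) = ≤-antisym (maxb _ pa a∣n) (maxa _ pb b∣n)

lpf≥2 : ∀ {n p} → 2 ≤ n → LargestPrimeFactor n p → 2 ≤ p
lpf≥2 2≤n (lpf-one refl) = contradiction 2≤n 1+n≰n
lpf≥2 _ (lpf-prime pp _ _) = prime⇒≥2 pp

prime∣⇒≤lpf : ∀ {m r q} → LargestPrimeFactor m r → Prime q → q ∣ m → q ≤ r
prime∣⇒≤lpf (lpf-one refl) pq q∣1 = contradiction q∣1 (prime∤1 pq)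
prime∣⇒≤lpf (lpf-prime _ _ max) pq q∣m = max _ pq q∣m

lpf-* : ∀ {p m r} → Prime p → LargestPrimeFactor m r → r ≤ p → LargestPrimeFactor (p * m) p
lpf-* {p} {m} pp lpf-m r≤p = lpf-prime pp (m∣m*n m) greatest
  where
  greatest : ∀ q → Prime q → q ∣ p * m → q ≤ p
  greatest q pq q∣pm with euclidsLemma p m pq q∣pm
  ... | inj₁ q∣p = ∣⇒≤ {{prime⇒nonZero pp}} q∣p
  ... | inj₂ q∣m = ≤-trans (prime∣⇒≤lpf lpf-m pq q∣m) r≤p

lpf-2^ : ∀ a → LargestPrimeFactor (2 ^ suc a) 2
lpf-2^ zero = lpf-* prime[2] (lpf-one refl) (s≤s z≤n)
lpf-2^ (suc a) = lpf-* prime[2] (lpf-2^ a) ≤-refl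

prime∣product⇒≤ : ∀ {p q qs} → All Prime qs → All (_≤ q) qs → Prime p → p ∣ product qs → p ≤ q
prime∣product⇒≤ [] [] pp p∣1 = contradiction p∣1 (prime∤1 pp)
prime∣product⇒≤ {qs = x ∷ qs} (px ∷ pqs) (x≤q ∷ qs≤q) pp p∣ with euclidsLemma x (product qs) pp p∣
... | inj₁ p∣x = subst (_≤ _) (sym (prime∣prime⇒≡ pp px p∣x)) x≤q
... | inj₂ p∣qs = prime∣product⇒≤ pqs qs≤q pp p∣qs

descending⇒bounded : ∀ {q qs} → Linked _≥_ (q ∷ qs) → All (_≤ q) qs
descending⇒bounded [-] = []
descending⇒bounded (q≥x ∷ desc) = Linkedₚ.Linked⇒All (λ x≥y y≥z → ≤-trans y≥z x≥y) q≥x desc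

lpf-head : ∀ {q qs} → All Prime (q ∷ qs) → Linked _≥_ (q ∷ qs) → LargestPrimeFactor (product (q ∷ qs)) q
lpf-head {q} {qs} (pq ∷ pqs) desc = lpf-prime pq (m∣m*n (product qs)) greatest
  where
  greatest : ∀ p → Prime p → p ∣ q * product qs → p ≤ q
  greatest p pp p∣ with euclidsLemma q (product qs) pp p∣
  ... | inj₁ p∣q = ≤-reflexive (prime∣prime⇒≡ pp pq p∣q)
  ... | inj₂ p∣qs = prime∣product⇒≤ pqs (descending⇒bounded desc) pp p∣qs

product≥2 : ∀ {q qs} → All Prime (q ∷ qs) → 2 ≤ product (q ∷ qs)
product≥2 (pq ∷ pqs) = *-mono-≤ (prime⇒≥2 pq) (productOfPrimes≥1 pqs)

product≡2^length : ∀ {qs} → All Prime qs → All (_≤ 2) qs → product qs ≡ 2 ^ length qs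
product≡2^length [] [] = refl
product≡2^length (pq ∷ pqs) (q≤2 ∷ qs≤2) =
  cong₂ _*_ (≤-antisym q≤2 (prime⇒≥2 pq)) (product≡2^length pqs qs≤2)

maximum-map-* : ∀ q xs → maximum (map (q *_) xs) ≡ q * maximum xs
maximum-map-* q [] = sym (*-zeroʳ q)
maximum-map-* q (x ∷ xs) =
  trans (cong (q * x ⊔_) (maximum-map-* q xs)) (sym (*-distribˡ-⊔ q x (maximum xs)))

maximum-sTerms : ∀ q qs → maximum (sTerms (q ∷ qs)) ≡ q * q ⊔ q * maximum (sTerms qs)
maximum-sTerms q qs = cong (q * q ⊔_) (maximum-map-* q (sTerms qs))

2*product≤maximum-sTerms : ∀ {q qs} → All Prime (q ∷ qs) →
  2 * product (q ∷ qs) ≤ maximum (sTerms (q ∷ qs))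
2*product≤maximum-sTerms {q} {[]} (pq ∷ []) = begin
  2 * (q * 1) ≡⟨ cong (2 *_) (*-identityʳ q) ⟩
  2 * q       ≤⟨ *-monoˡ-≤ q (prime⇒≥2 pq) ⟩
  q * q       ≤⟨ m≤m⊔n (q * q) 0 ⟩
  q * q ⊔ 0   ∎
  where open ≤-Reasoning
2*product≤maximum-sTerms {q} {x ∷ xs} (pq ∷ pxs) = begin
  2 * (q * product (x ∷ xs))            ≡⟨ *-swapˡ 2 q _ ⟩
  q * (2 * product (x ∷ xs))            ≤⟨ *-monoʳ-≤ q (2*product≤maximum-sTerms pxs) ⟩
  q * maximum (sTerms (x ∷ xs))         ≤⟨ m≤n⊔m (q * q) _ ⟩
  q * q ⊔ q * maximum (sTerms (x ∷ xs)) ≡⟨ maximum-sTerms q (x ∷ xs) ⟨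
  maximum (sTerms (q ∷ x ∷ xs))         ∎
  where open ≤-Reasoning

factorization-tail : ∀ {p qs} → All Prime (p ∷ qs) → Linked _≥_ (p ∷ qs) →
  (∃ λ r → LargestPrimeFactor (product qs) r × r ≤ p) ×
  (∃ λ s → SValue (product qs) s × p * s ≤ maximum (sTerms (p ∷ qs)))
factorization-tail {p} {[]} (pp ∷ []) _ =
  (1 , lpf-one refl , ≤-trans (s≤s z≤n) (prime⇒≥2 pp)) ,
  (1 , s-one refl , ≤-trans (*-monoʳ-≤ p (≤-trans (s≤s z≤n) (prime⇒≥2 pp))) (m≤m⊔n (p * p) 0))
factorization-tail {p} {x ∷ xs} (pp ∷ pxs) (p≥x ∷ desc) =
  (x , lpf-head pxs desc , p≥x) ,
  (maximum (sTerms (x ∷ xs)) , s-fact (x ∷ xs) (product≥2 pxs) pxs desc refl ,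
   ≤-trans (m≤n⊔m (p * p) _) (≤-reflexive (sym (maximum-sTerms p (x ∷ xs)))))

-- The set 𝒜

-- The primes of 𝒜(x/2, y), since S(p) = p² for a prime p.
PrimeInA : ℕ → ℕ → ℕ → Set
PrimeInA X Y p = Prime p × 2 * (p * p) ≤ X × p ≤ Y

primeInA? : ∀ X Y p → Dec (PrimeInA X Y p)
primeInA? X Y p = prime? p ×-dec (2 * (p * p) ≤? X) ×-dec (p ≤? Y)

primeInA-downward : ∀ {X Y p q} → PrimeInA X Y p → Prime q → q ≤ p → PrimeInA X Y q
primeInA-downward (_ , 2p²≤X , p≤Y) pq q≤p =
  pq , ≤-trans (*-monoʳ-≤ 2 (*-mono-≤ q≤p q≤p)) 2p²≤X , ≤-trans q≤p p≤Y

InA⇒factorization : ∀ {X Y n p} → InA X Y n → LargestPrimeFactor n p → 2 ≤ p →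
  ∃ λ qs → All Prime (p ∷ qs) × Linked _≥_ (p ∷ qs) × product (p ∷ qs) ≡ n ×
           2 * maximum (sTerms (p ∷ qs)) ≤ X × p ≤ Y
InA⇒factorization (_ , _ , _ , s-one refl , _) lpf 2≤p =
  contradiction (subst (2 ≤_) (lpf-unique lpf (lpf-one refl)) 2≤p) 1+n≰n
InA⇒factorization (_ , _ , _ , s-fact [] 2≤1 _ _ refl , _) _ _ = contradiction 2≤1 1+n≰n
InA⇒factorization (_ , (q , lpf-q , q≤Y) , _ , s-fact (p′ ∷ qs) _ primes desc refl , 2S≤X) lpf-p _
  with lpf-unique (lpf-head primes desc) lpf-p | lpf-unique (lpf-head primes desc) lpf-q
... | refl | refl = qs , primes , desc , refl , 2S≤X , q≤Y

InA⇒primeInA : ∀ {X Y n p} → InA X Y n → LargestPrimeFactor n p → 2 ≤ p → PrimeInA X Y p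
InA⇒primeInA {X} {p = p} a lpf 2≤p with InA⇒factorization a lpf 2≤p
... | qs , pp ∷ _ , _ , _ , 2S≤X , p≤Y = pp , ≤-trans (*-monoʳ-≤ 2 p²≤S) 2S≤X , p≤Y
  where
  p²≤S : p * p ≤ maximum (sTerms (p ∷ qs))
  p²≤S = ≤-trans (m≤m⊔n (p * p) _) (≤-reflexive (sym (maximum-sTerms p qs)))

InA⇒4*n≤X : ∀ {X Y n p} → InA X Y n → LargestPrimeFactor n p → 2 ≤ p → 4 * n ≤ X
InA⇒4*n≤X {X} {p = p} a lpf 2≤p with InA⇒factorization a lpf 2≤p
... | qs , primes , _ , refl , 2S≤X , _ = begin
  4 * product (p ∷ qs)              ≡⟨ *-assoc 2 2 (product (p ∷ qs)) ⟩
  2 * (2 * product (p ∷ qs))        ≤⟨ *-monoʳ-≤ 2 (2*product≤maximum-sTerms primes) ⟩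
  2 * maximum (sTerms (p ∷ qs))     ≤⟨ 2S≤X ⟩
  X                                 ∎
  where open ≤-Reasoning

-- S(p m) = max(p², p S(m)) when P(m) ≤ p, so 2 S(p m) ≤ x bounds S(m) by x / (2p).
InA-peel : ∀ {X Y n p} .{{_ : NonZero p}} → InA X Y n → LargestPrimeFactor n p → 2 ≤ p →
  ∃ λ m → n ≡ p * m × InA (X / p) p m
InA-peel {X} {p = p} a lpf 2≤p with InA⇒factorization a lpf 2≤p
... | qs , primes@(_ ∷ pqs) , desc , refl , 2S≤X , _ with factorization-tail primes desc
...   | lpf-m , (s , S-m , ps≤S) =
  product qs , refl , productOfPrimes≥1 pqs , lpf-m , s , S-m , *≤⇒≤/ p (2 * s) X p2s≤X
  where
  open ≤-Reasoning
  p2s≤X : p * (2 * s) ≤ X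
  p2s≤X = begin
    p * (2 * s)                     ≡⟨ *-swapˡ p 2 s ⟩
    2 * (p * s)                     ≤⟨ *-monoʳ-≤ 2 ps≤S ⟩
    2 * maximum (sTerms (p ∷ qs))   ≤⟨ 2S≤X ⟩
    X                               ∎

InA⇒powerOf2 : ∀ {X Y n} → InA X Y n → LargestPrimeFactor n 2 → ∃ λ a → n ≡ 2 ^ suc a
InA⇒powerOf2 a lpf with InA⇒factorization a lpf ≤-refl
... | qs , primes , desc , refl , _ =
  length qs , product≡2^length primes (≤-refl ∷ descending⇒bounded desc)

All⇒All-head : ∀ {A : Set} {P : A → Set} {xs} → All P xs → Maybe.All P (head xs)
All⇒All-head [] = nothing
All⇒All-head (px ∷ _) = just px

All⇒All-last : ∀ {A : Set} {P : A → Set} {xs} → All P xs → Maybe.All P (last xs)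
All⇒All-last [] = nothing
All⇒All-last (px ∷ []) = just px
All⇒All-last (_ ∷ pxs@(_ ∷ _)) = All⇒All-last pxs

All-head-++ : ∀ {A : Set} {P : A → Set} xs {ys} →
  Maybe.All P (head xs) → Maybe.All P (head ys) → Maybe.All P (head (xs ++ ys))
All-head-++ [] _ Pys = Pys
All-head-++ (_ ∷ _) Pxs _ = Pxs

All-disjoint : ∀ {A : Set} {P Q : A → Set} {xs ys} →
  All P xs → All Q ys → (∀ {x} → P x → Q x → ⊥) → Disjoint xs ys
All-disjoint pxs qys P∩Q=∅ (x∈xs , x∈ys) = P∩Q=∅ (All.lookup pxs x∈xs) (All.lookup qys x∈ys)

last-++ : ∀ {A : Set} (xs : List A) y ys → last (xs ++ y ∷ ys) ≡ last (y ∷ ys)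
last-++ [] y ys = refl
last-++ (x ∷ []) y ys = refl
last-++ (x ∷ xs@(_ ∷ _)) y ys = last-++ xs y ys

last-++ʳ : ∀ {A : Set} xs {ys : List A} {b} → last ys ≡ just b → last (xs ++ ys) ≡ just b
last-++ʳ xs {y ∷ ys} last≡b = trans (last-++ xs y ys) last≡b

last-applyDownFrom : ∀ {A : Set} (f : ℕ → A) n → last (applyDownFrom f (suc n)) ≡ just (f 0)
last-applyDownFrom f zero = refl
last-applyDownFrom f (suc n) = last-applyDownFrom f n

head-ʳ++ : ∀ {A : Set} (xs : List A) y ys → head (xs ʳ++ y ∷ ys) ≡ last (y ∷ xs)
head-ʳ++ [] y ys = refl
head-ʳ++ (x ∷ xs) y ys = head-ʳ++ xs x (y ∷ ys)

last-ʳ++ : ∀ {A : Set} (xs : List A) y ys → last (xs ʳ++ y ∷ ys) ≡ last (y ∷ ys)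
last-ʳ++ [] y ys = refl
last-ʳ++ (x ∷ xs) y ys = last-ʳ++ xs x (y ∷ ys)

Linked-ʳ++ : ∀ {A : Set} {R : A → A → Set} → Symmetric R →
  ∀ {xs y ys} → Linked R (y ∷ xs) → Linked R (y ∷ ys) → Linked R (xs ʳ++ y ∷ ys)
Linked-ʳ++ R-sym {[]} _ Ryys = Ryys
Linked-ʳ++ R-sym {x ∷ xs} (Ryx ∷ Rxxs) Ryys = Linked-ʳ++ R-sym Rxxs (R-sym Ryx ∷ Ryys)

head-reverse : ∀ {A : Set} (xs : List A) → head (reverse xs) ≡ last xs
head-reverse [] = refl
head-reverse (x ∷ xs) = head-ʳ++ xs x []

last-reverse : ∀ {A : Set} (xs : List A) → last (reverse xs) ≡ head xs
last-reverse [] = refl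
last-reverse (x ∷ xs) = last-ʳ++ xs x []

Linked-reverse : ∀ {A : Set} {R : A → A → Set} → Symmetric R →
  ∀ {xs} → Linked R xs → Linked R (reverse xs)
Linked-reverse R-sym {[]} [] = []
Linked-reverse R-sym {x ∷ xs} Rxxs = Linked-ʳ++ R-sym Rxxs [-]

-- Chains

Step-sym : ∀ {a b} → Step a b → Step b a
Step-sym (a<b⇒a∣b , b<a⇒b∣a) = b<a⇒b∣a , a<b⇒a∣b

∣⇒Step : ∀ {a b} → a ∣ b → 0 < b → Step a b
∣⇒Step {b = suc _} a∣b _ = (λ _ → a∣b) , (λ b<a → contradiction (∣⇒≤ a∣b) (<⇒≱ b<a))

Step-* : ∀ p {a b} → Step a b → Step (p * a) (p * b)
Step-* p (a<b⇒a∣b , b<a⇒b∣a) =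
  (λ pa<pb → *-monoʳ-∣ p (a<b⇒a∣b (*-cancelˡ-< p _ _ pa<pb))) ,
  (λ pb<pa → *-monoʳ-∣ p (b<a⇒b∣a (*-cancelˡ-< p _ _ pb<pa)))

connected-1ʳ : ∀ {m} → Maybe.All (1 ≤_) m → Connected Step m (just 1)
connected-1ʳ nothing = nothing-just
connected-1ʳ (just 1≤x) = just (Step-sym (∣⇒Step (1∣ _) 1≤x))

connected-1ˡ : ∀ {m} → Maybe.All (1 ≤_) m → Connected Step (just 1) m
connected-1ˡ nothing = just-nothing
connected-1ˡ (just 1≤x) = just (∣⇒Step (1∣ _) 1≤x)

singleton-Chain : ∀ {x} → 1 ≤ x → Chain [ x ]
singleton-Chain 1≤x = [] ∷ [] , 1≤x ∷ [] , [-]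

++-Chain : ∀ {xs ys} → Chain xs → Chain ys → Disjoint xs ys →
  Connected Step (last xs) (head ys) → Chain (xs ++ ys)
++-Chain (u , pos , lk) (u′ , pos′ , lk′) disjoint connected =
  Uniqueₚ.++⁺ u u′ disjoint , Allₚ.++⁺ pos pos′ , Linkedₚ.++⁺ lk connected lk′

map-*-Chain : ∀ p {xs} → 1 ≤ p → Chain xs → Chain (map (p *_) xs)
map-*-Chain p 1≤p (u , pos , lk) =
  Uniqueₚ.map⁺ (*-cancelˡ-≡ _ _ p {{>-nonZero 1≤p}}) u ,
  Allₚ.map⁺ (All.map (*-mono-≤ 1≤p) pos) ,
  Linkedₚ.map⁺ (Linked.map (Step-* p) lk)

reverse-Chain : ∀ {xs} → Chain xs → Chain (reverse xs)
reverse-Chain {xs} (u , pos , lk) =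
  Unique-resp-↭ (setoid ℕ) (↭⇒↭ₛ (↭-sym (↭-reverse xs))) u ,
  All-resp-↭ (↭-sym (↭-reverse xs)) pos ,
  Linked-reverse Step-sym lk

-- The induction step

CoveringChain : ℕ → ℕ → Set
CoveringChain X Y = ∃ λ (c : List ℕ) → Chain c × All (InS X Y) c ×
  (∃ λ b → StartValue (jIndex X Y) b × head c ≡ just b) × last c ≡ just 2 ×
  (∀ n → InA X Y n → n ∈ c)

module InductionStep (X Y : ℕ) (2≤X : 2 ≤ X) (2≤Y : 2 ≤ Y)
  (ih : ∀ {X′} → X′ < X → ∀ Y′ → 2 ≤ X′ → 2 ≤ Y′ → CoveringChain X′ Y′) where

  instance
    X≢0 : NonZero X
    X≢0 = >-nonZero (≤-trans (s≤s z≤n) 2≤X)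

  Admissible : ℕ → Set
  Admissible = PrimeInA X Y

  admissible⇒8≤X : ∀ {p} → Admissible p → 8 ≤ X
  admissible⇒8≤X (pp , 2p²≤X , _) =
    ≤-trans (*-monoʳ-≤ 2 (*-mono-≤ (prime⇒≥2 pp) (prime⇒≥2 pp))) 2p²≤X

  lpf-admissible : ∀ {n p} → InA X Y n → 3 ≤ n → LargestPrimeFactor n p → Admissible p
  lpf-admissible a 3≤n lpf = InA⇒primeInA a lpf (lpf≥2 (≤-trans (n≤1+n 2) 3≤n) lpf)

  Large : ℕ → Set
  Large x = InS X Y x × 3 ≤ x

  record Segment (p : ℕ) : Set where
    field
      prev : ℕ
      prev-greatest : GreatestPrime≤ (p ∸ 1) prev
      elems : List ℕ
      chain : Chain elems
      large : All (λ x → Large x × LargestPrimeFactor x p) elems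
      head≡ : head elems ≡ just (p * (2 * prev))
      last≡ : last elems ≡ just (p * 2)
      covers : ∀ n → InA X Y n → LargestPrimeFactor n p → n ∈ elems

  -- p times the chain for (x/p, p); it starts at 2q, q the prime preceding p,
  -- since 2p² ≤ x makes j(x/p, p) = π(p).
  segment : ∀ {p} → Admissible p → 3 ≤ p → Segment p
  segment {p} (pp , 2p²≤X , p≤Y) 3≤p = scale (ih (m/n<m X p (prime⇒≥2 pp)) p 2≤X/p (prime⇒≥2 pp))
    where
    instance
      p≢0 : NonZero p
      p≢0 = prime⇒nonZero pp
    2p≤X/p : 2 * p ≤ X / p
    2p≤X/p = *≤⇒≤/ p (2 * p) X (subst (_≤ X) (*-swapˡ 2 p p) 2p²≤X)
    2≤X/p : 2 ≤ X / p
    2≤X/p = ≤-trans (≤-trans (prime⇒≥2 pp) (m≤n*m p 2)) 2p≤X/p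
    jIndex≡ : jIndex (X / p) p ≡ suc (primePi (p ∸ 1))
    jIndex≡ = trans (cong primePi (m≤n⇒m⊓n≡m (*≤⇒≤/ 2 p (X / p) 2p≤X/p))) (primePi-prime pp)
    scale-elem : ∀ {y} → InS (X / p) p y → Large (p * y) × LargestPrimeFactor (p * y) p
    scale-elem {y} (1≤y , y≤X/p , r , lpf-y , r≤p) =
      ((*-mono-≤ (≤-trans (s≤s z≤n) 3≤p) 1≤y , ≤-trans (*-monoʳ-≤ p y≤X/p) (*/≤ p X) , p , lpf-py , p≤Y) ,
       ≤-trans 3≤p (m≤m*n p y {{>-nonZero 1≤y}})) , lpf-py
      where lpf-py = lpf-* pp lpf-y r≤p
    scale : CoveringChain (X / p) p → Segment p
    scale (c , chain , inS , (b , sv , head≡b) , last≡2 , covers)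
      with startValue⇒greatestPrime≤ (∸-monoˡ-≤ 1 3≤p) (subst (λ j → StartValue j b) jIndex≡ sv)
    ... | q , refl , q-greatest = record
      { prev = q
      ; prev-greatest = q-greatest
      ; elems = map (p *_) c
      ; chain = map-*-Chain p (≤-trans (s≤s z≤n) 3≤p) chain
      ; large = Allₚ.map⁺ (All.map scale-elem inS)
      ; head≡ = trans (head-map c) (cong (Data.Maybe.map (p *_)) head≡b)
      ; last≡ = trans (last-map (p *_) c) (cong (Data.Maybe.map (p *_)) last≡2)
      ; covers = covers′
      }
      where
      covers′ : ∀ n → InA X Y n → LargestPrimeFactor n p → n ∈ map (p *_) c
      covers′ n a lpf with InA-peel a lpf (prime⇒≥2 pp)
      ... | m , refl , a-m = ∈-map⁺ (p *_) (covers m a-m)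

  Rung : ℕ → ℕ → Set
  Rung N x = Large x × ∃ λ p → LargestPrimeFactor x p × Admissible p × p ≤ N

  GreatestAdmissible≤ : ℕ → ℕ → Set
  GreatestAdmissible≤ N g = Admissible g × g ≤ N × (∀ p → Admissible p → p ≤ N → p ≤ g)

  data LadderTop (N : ℕ) (xs : List ℕ) : Set where
    none : (∀ p → Admissible p → p ≤ N → ⊥) → LadderTop N xs
    some : ∀ g → GreatestAdmissible≤ N g → last xs ≡ just (2 * g) → LadderTop N xs

  -- A chain through the n ≥ 3 of 𝒜 with P(n) ≤ N: the powers of 2 downwards, then the segments of the
  -- admissible primes p ≥ 3 upwards, each ending at 2p where the next one begins.
  record Ladder (N : ℕ) : Set where
    field
      rungs : List ℕ
      chain : Chain rungs
      all-rungs : All (Rung N) rungs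
      head-even : Maybe.All (2 ∣_) (head rungs)
      top : LadderTop N rungs
      covers : ∀ n p → InA X Y n → 3 ≤ n → LargestPrimeFactor n p → p ≤ N → n ∈ rungs

  ladder₀ : Ladder 0
  ladder₀ = record
    { rungs = []
    ; chain = [] , [] , []
    ; all-rungs = []
    ; head-even = nothing
    ; top = none λ p adm p≤0 → contradiction (≤-trans (prime⇒≥2 (proj₁ adm)) p≤0) λ ()
    ; covers = λ n p a 3≤n lpf p≤0 →
        contradiction (≤-trans (lpf≥2 (≤-trans (n≤1+n 2) 3≤n) lpf) p≤0) λ ()
    }

  ladder-skip : ∀ {N} → ¬ Admissible (suc N) → Ladder N → Ladder (suc N)
  ladder-skip {N} ¬adm L = record
    { rungs = rungs
    ; chain = chain
    ; all-rungs = All.map (λ (l , p , lpf , adm , p≤N) → l , p , lpf , adm , m≤n⇒m≤1+n p≤N) all-rungs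
    ; head-even = head-even
    ; top = top′ top
    ; covers = λ n p a 3≤n lpf p≤1+N → covers n p a 3≤n lpf (below (lpf-admissible a 3≤n lpf) p≤1+N)
    }
    where
    open Ladder L
    below : ∀ {p} → Admissible p → p ≤ suc N → p ≤ N
    below adm p≤1+N with ≤⇒≡∨≤∸1 p≤1+N
    ... | inj₁ refl = contradiction adm ¬adm
    ... | inj₂ p≤N = p≤N
    top′ : LadderTop N rungs → LadderTop (suc N) rungs
    top′ (none no-adm) = none λ p adm p≤1+N → no-adm p adm (below adm p≤1+N)
    top′ (some g (adm , g≤N , max) last≡2g) =
      some g (adm , m≤n⇒m≤1+n g≤N , λ p adm p≤1+N → max p adm (below adm p≤1+N)) last≡2g

  ladder-powers : Admissible 2 → Ladder 2
  ladder-powers adm with 2^-bracket X (≤-trans (s≤s z≤n) 2≤X)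
  ... | 0 , _ , X<2 = contradiction 2≤X (<⇒≱ X<2)
  ... | 1 , _ , X<4 =
    contradiction (≤-trans (s≤s (s≤s (s≤s (s≤s z≤n)))) (admissible⇒8≤X adm)) (<⇒≱ X<4)
  ... | suc (suc k) , 2^e≤X , X<2^1+e = record
    { rungs = powers
    ; chain = Uniqueₚ.applyDownFrom⁺₁ power (suc k) (λ j<i _ → >⇒≢ (power-< j<i)) ,
              Allₚ.applyDownFrom⁺₂ power (suc k) (λ i → m^n>0 2 (2 + i)) ,
              Linkedₚ.applyDownFrom⁺₂ power (suc k) (λ i → Step-sym (∣⇒Step (n∣m*n 2) (m^n>0 2 (3 + i))))
    ; all-rungs = Allₚ.applyDownFrom⁺₁ power (suc k) rung
    ; head-even = just (m∣m*n (2 ^ suc k))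
    ; top = some 2 (adm , ≤-refl , λ _ _ p≤2 → p≤2) (last-applyDownFrom power k)
    ; covers = covers
    }
    where
    power : ℕ → ℕ
    power i = 2 ^ (2 + i)
    powers : List ℕ
    powers = applyDownFrom power (suc k)
    power-< : ∀ {i j} → i < j → power i < power j
    power-< i<j = ^-monoʳ-< 2 (s≤s (s≤s z≤n)) (s≤s (s≤s i<j))
    rung : ∀ {i} → i < suc k → Rung 2 (power i)
    rung {i} i<1+k =
      ((m^n>0 2 (2 + i) , ≤-trans (^-monoʳ-≤ 2 (s≤s (s≤s (s≤s⁻¹ i<1+k)))) 2^e≤X , 2 , lpf-2^ (suc i) , 2≤Y) ,
       ≤-trans (n≤1+n 3) (^-monoʳ-≤ 2 {2} {2 + i} (s≤s (s≤s z≤n)))) ,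
      2 , lpf-2^ (suc i) , adm , ≤-refl
    covers : ∀ n p → InA X Y n → 3 ≤ n → LargestPrimeFactor n p → p ≤ 2 → n ∈ powers
    covers n p a 3≤n lpf p≤2 with ≤-antisym p≤2 (lpf≥2 (≤-trans (n≤1+n 2) 3≤n) lpf)
    ... | refl with InA⇒powerOf2 a lpf
    ...   | zero , refl = contradiction 3≤n λ { (s≤s (s≤s ())) }
    ...   | suc i , refl =
      Anyₚ.applyDownFrom⁺ power {i} refl (≰⇒> λ 1+k≤i → <⇒≱ n<2^1+e (^-monoʳ-≤ 2 (s≤s (s≤s 1+k≤i))))
      where
      n<2^1+e : power i < 2 ^ suc (suc (suc k))
      n<2^1+e = ≤-<-trans (≤-trans (m≤n*m (power i) 4) (InA⇒4*n≤X a lpf ≤-refl)) X<2^1+e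

  segment-head-even : ∀ {p} (S : Segment p) → Maybe.All (2 ∣_) (head (Segment.elems S))
  segment-head-even {p} S = subst (Maybe.All (2 ∣_)) (sym head≡) (just (∣-trans (m∣m*n prev) (n∣m*n p)))
    where open Segment S

  -- Below an admissible p ≥ 3 every prime is admissible, so a ladder up to p - 1 ends at 2q.
  ladder-last : ∀ {p q} → Admissible p → 3 ≤ p → GreatestPrime≤ (p ∸ 1) q → (L : Ladder (p ∸ 1)) →
    last (Ladder.rungs L) ≡ just (2 * q)
  ladder-last {p} {q} adm 3≤p (pq , q≤p-1 , greatest) L with Ladder.top L
  ... | none no-adm =
    contradiction (∸-monoˡ-≤ 1 3≤p) (no-adm 2 (primeInA-downward adm prime[2] (≤-trans (n≤1+n 2) 3≤p)))
  ... | some g (adm-g , g≤p-1 , max) last≡2g = trans last≡2g (cong (λ x → just (2 * x)) g≡q)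
    where
    g≡q : g ≡ q
    g≡q = ≤-antisym (greatest g (proj₁ adm-g) g≤p-1)
                    (max q (primeInA-downward adm pq (≤-trans q≤p-1 (m∸n≤m p 1))) q≤p-1)

  ladder-extend : ∀ {N} → Admissible (suc N) → 3 ≤ suc N → Ladder N → Ladder (suc N)
  ladder-extend {N} adm 3≤1+N L = record
    { rungs = rungs ++ S.elems
    ; chain = ++-Chain chain S.chain (All-disjoint all-rungs S.large below-vs-top) connected
    ; all-rungs = Allₚ.++⁺
        (All.map (λ (l , p , lpf , adm , p≤N) → l , p , lpf , adm , m≤n⇒m≤1+n p≤N) all-rungs)
        (All.map (λ (l , lpf) → l , suc N , lpf , adm , ≤-refl) S.large)
    ; head-even = All-head-++ rungs head-even (segment-head-even S)
    ; top = some (suc N) (adm , ≤-refl , λ _ _ p≤1+N → p≤1+N)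
                 (last-++ʳ rungs (trans S.last≡ (cong just (*-comm (suc N) 2))))
    ; covers = covers′
    }
    where
    open Ladder L
    S = segment adm 3≤1+N
    module S = Segment S
    below-vs-top : ∀ {x} → Rung N x → Large x × LargestPrimeFactor x (suc N) → ⊥
    below-vs-top (_ , p , lpf-p , _ , p≤N) (_ , lpf-1+N) =
      1+n≰n (subst (_≤ N) (lpf-unique lpf-p lpf-1+N) p≤N)
    connected : Connected Step (last rungs) (head S.elems)
    2q>0 : 0 < 2 * S.prev
    2q>0 = ≤-trans (s≤s z≤n) (≤-trans (prime⇒≥2 (proj₁ S.prev-greatest)) (m≤n*m S.prev 2))
    connected = subst₂ (Connected Step) (sym (ladder-last adm 3≤1+N S.prev-greatest L)) (sym S.head≡)
      (just (∣⇒Step (n∣m*n (suc N)) (*-mono-≤ {1} {suc N} {1} {2 * S.prev} (s≤s z≤n) 2q>0)))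
    covers′ : ∀ n p → InA X Y n → 3 ≤ n → LargestPrimeFactor n p → p ≤ suc N → n ∈ rungs ++ S.elems
    covers′ n p a 3≤n lpf p≤1+N with ≤⇒≡∨≤∸1 p≤1+N
    ... | inj₁ refl = ∈-++⁺ʳ rungs (S.covers n a lpf)
    ... | inj₂ p≤N = ∈-++⁺ˡ (covers n p a 3≤n lpf p≤N)

  ladder : ∀ N → Ladder N
  ladder zero = ladder₀
  ladder (suc N) with primeInA? X Y (suc N)
  ... | no ¬adm = ladder-skip ¬adm (ladder N)
  ladder (suc zero) | yes (p1 , _) = contradiction (prime⇒≥2 p1) 1+n≰n
  ladder (suc (suc zero)) | yes adm = ladder-powers adm
  ladder (suc (suc (suc N))) | yes adm = ladder-extend adm (s≤s (s≤s (s≤s z≤n))) (ladder (suc (suc N)))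

  M : ℕ
  M = Y ⊓ (X / 2)

  admissible⇒≤M : ∀ {p} → Admissible p → p ≤ M
  admissible⇒≤M {p} (pp , 2p²≤X , p≤Y) =
    ⊓-glb p≤Y (*≤⇒≤/ 2 p X (≤-trans (*-monoʳ-≤ 2 (m≤m*n p p {{prime⇒nonZero pp}})) 2p²≤X))

  InS-1 : InS X Y 1
  InS-1 = ≤-refl , ≤-trans (s≤s z≤n) 2≤X , 1 , lpf-one refl , ≤-trans (s≤s z≤n) 2≤Y

  InS-2 : InS X Y 2
  InS-2 = s≤s z≤n , 2≤X , 2 , lpf-2^ 0 , 2≤Y

  -- The chain is 2, mid, 1, tail read backwards: 1 can be linked to anything, and 2 follows an even number.
  assemble : ∀ {b} mid tail → StartValue (jIndex X Y) b → last (1 ∷ tail) ≡ just b →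
    Chain mid → Chain tail → All Large mid → All Large tail → Disjoint mid tail →
    Maybe.All (2 ∣_) (head mid) → (∀ n → InA X Y n → 3 ≤ n → n ∈ mid ⊎ n ∈ tail) → CoveringChain X Y
  assemble {b} mid tail sv last≡b mid-chain tail-chain mid-large tail-large disjoint mid-even covers =
    reverse path , reverse-Chain path-chain ,
    All-resp-↭ path↭ path-inS ,
    (b , sv , trans (head-reverse path) (trans (last-++ (2 ∷ mid) 1 tail) last≡b)) ,
    last-reverse path ,
    λ n a → ∈-resp-↭ path↭ (path-covers n a)
    where
    path : List ℕ
    path = 2 ∷ mid ++ 1 ∷ tail
    path↭ = ↭-sym (↭-reverse path)
    small∉ : ∀ {x xs} → All Large xs → x < 3 → x ∉ xs
    small∉ large x<3 x∈xs = <⇒≱ x<3 (proj₂ (All.lookup large x∈xs))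
    1∷tail-chain : Chain (1 ∷ tail)
    1∷tail-chain = ++-Chain (singleton-Chain ≤-refl) tail-chain
      (λ { (here refl , 1∈tail) → small∉ tail-large (s≤s (s≤s z≤n)) 1∈tail })
      (connected-1ˡ (All⇒All-head (proj₁ (proj₂ tail-chain))))
    mid∩1∷tail=∅ : Disjoint mid (1 ∷ tail)
    mid∩1∷tail=∅ (1∈mid , here refl) = small∉ mid-large (s≤s (s≤s z≤n)) 1∈mid
    mid∩1∷tail=∅ (x∈mid , there x∈tail) = disjoint (x∈mid , x∈tail)
    2∉ : 2 ∉ mid ++ 1 ∷ tail
    2∉ 2∈ with ∈-++⁻ mid 2∈
    ... | inj₁ 2∈mid = small∉ mid-large ≤-refl 2∈mid
    ... | inj₂ (there 2∈tail) = small∉ tail-large ≤-refl 2∈tail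
    2→ : ∀ xs → Maybe.All (2 ∣_) (head xs) → All Large xs → Connected Step (just 2) (head (xs ++ 1 ∷ tail))
    2→ [] _ _ = just (Step-sym (∣⇒Step (1∣ 2) (s≤s z≤n)))
    2→ (x ∷ _) (just 2∣x) ((_ , 3≤x) ∷ _) = just (∣⇒Step 2∣x (≤-trans (s≤s z≤n) 3≤x))
    path-chain : Chain path
    path-chain = ++-Chain (singleton-Chain (s≤s z≤n))
      (++-Chain mid-chain 1∷tail-chain mid∩1∷tail=∅ (connected-1ʳ (All⇒All-last (proj₁ (proj₂ mid-chain)))))
      (λ { (here refl , 2∈) → 2∉ 2∈ })
      (2→ mid mid-even mid-large)
    path-inS : All (InS X Y) path
    path-inS = InS-2 ∷ Allₚ.++⁺ (All.map proj₁ mid-large) (InS-1 ∷ All.map proj₁ tail-large)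
    path-covers : ∀ n → InA X Y n → n ∈ path
    path-covers (suc zero) _ = there (∈-++⁺ʳ mid (here refl))
    path-covers (suc (suc zero)) _ = here refl
    path-covers n@(suc (suc (suc _))) a with covers n a (s≤s (s≤s (s≤s z≤n)))
    ... | inj₁ n∈mid = there (∈-++⁺ˡ n∈mid)
    ... | inj₂ n∈tail = there (∈-++⁺ʳ mid (there n∈tail))

  ladder-covers-A : (L : Ladder M) → ∀ n → InA X Y n → 3 ≤ n → n ∈ Ladder.rungs L
  ladder-covers-A L n a@(_ , (p , lpf , _) , _) 3≤n =
    Ladder.covers L n p a 3≤n lpf (admissible⇒≤M (lpf-admissible a 3≤n lpf))

  -- q = p_{j-1} bounds the admissible primes: if q is admissible the reversed ladder starts at 2q,
  -- otherwise 2q is put in front of 1.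
  chain-below : ∀ {q} → Prime q → q ≤ M → StartValue (jIndex X Y) (2 * q) → (∀ p → Admissible p → p ≤ q) →
    CoveringChain X Y
  chain-below {q} pq q≤M sv admissible≤q = from (primeInA? X Y q)
    where
    open Ladder (ladder M)
    large-rungs : All Large rungs
    large-rungs = All.map proj₁ all-rungs
    from : Dec (Admissible q) → CoveringChain X Y
    from (yes adm-q) = assemble [] rungs sv (last-++ʳ [ 1 ] {rungs} last≡2q) ([] , [] , []) chain [] large-rungs
      (λ ()) nothing (λ n a 3≤n → inj₂ (ladder-covers-A (ladder M) n a 3≤n))
      where
      last≡2q : last rungs ≡ just (2 * q)
      last≡2q with top
      ... | none no-adm = contradiction q≤M (no-adm q adm-q)
      ... | some g (adm-g , _ , max) last≡2g =
        trans last≡2g (cong (λ x → just (2 * x)) (≤-antisym (admissible≤q g adm-g) (max q adm-q q≤M)))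
    from (no ¬adm-q) = assemble rungs [ 2 * q ] sv refl chain (singleton-Chain (proj₁ (proj₁ large-2q)))
      large-rungs (large-2q ∷ []) rungs∌2q head-even (λ n a 3≤n → inj₁ (ladder-covers-A (ladder M) n a 3≤n))
      where
      lpf-2q : LargestPrimeFactor (2 * q) q
      lpf-2q = subst (λ m → LargestPrimeFactor m q) (*-comm q 2) (lpf-* pq (lpf-2^ 0) (prime⇒≥2 pq))
      large-2q : Large (2 * q)
      large-2q =
        (≤-trans (s≤s z≤n) (*-monoʳ-≤ 2 (prime⇒≥2 pq)) ,
         ≤-trans (*-monoʳ-≤ 2 (≤-trans q≤M (m⊓n≤n Y (X / 2)))) (*/≤ 2 X) ,
         q , lpf-2q , ≤-trans q≤M (m⊓n≤m Y (X / 2))) ,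
        ≤-trans (n≤1+n 3) (*-monoʳ-≤ 2 (prime⇒≥2 pq))
      rungs∌2q : Disjoint rungs [ 2 * q ]
      rungs∌2q (2q∈rungs , here refl) with All.lookup all-rungs 2q∈rungs
      ... | _ , p , lpf-p , adm-p , _ = ¬adm-q (subst Admissible (lpf-unique lpf-p lpf-2q) adm-p)

  -- p_j = r ≥ 3 admissible: the segment of r goes between 2 and 1, the ladder below r (ending at 2q) after 1.
  chain-through : ∀ {r q} → GreatestPrime≤ M r → Admissible r → 3 ≤ r → GreatestPrime≤ (r ∸ 1) q →
    StartValue (jIndex X Y) (2 * q) → CoveringChain X Y
  chain-through {r} {q} (pr , _ , greatest-r) adm-r 3≤r gq sv =
    assemble S.elems rungs sv (last-++ʳ [ 1 ] {rungs} (ladder-last adm-r 3≤r gq (ladder (r ∸ 1))))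
      S.chain chain
      (All.map proj₁ S.large) (All.map proj₁ all-rungs) (All-disjoint S.large all-rungs at-r-vs-below)
      (segment-head-even S) covers′
    where
    S = segment adm-r 3≤r
    module S = Segment S
    open Ladder (ladder (r ∸ 1))
    r≰r∸1 : ¬ r ≤ r ∸ 1
    r≰r∸1 = <⇒≱ (∸-monoʳ-< {o = 0} (s≤s z≤n) (≤-trans (s≤s z≤n) 3≤r))
    at-r-vs-below : ∀ {x} → Large x × LargestPrimeFactor x r → Rung (r ∸ 1) x → ⊥
    at-r-vs-below (_ , lpf-r) (_ , p , lpf-p , _ , p≤r∸1) =
      r≰r∸1 (subst (_≤ r ∸ 1) (lpf-unique lpf-p lpf-r) p≤r∸1)
    covers′ : ∀ n → InA X Y n → 3 ≤ n → n ∈ S.elems ⊎ n ∈ rungs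
    covers′ n a@(_ , (p , lpf , _) , _) 3≤n
      with ≤⇒≡∨≤∸1 (greatest-r p (proj₁ adm-p) (admissible⇒≤M adm-p))
      where adm-p = lpf-admissible a 3≤n lpf
    ... | inj₁ refl = inj₁ (S.covers n a lpf)
    ... | inj₂ p≤r∸1 = inj₂ (covers n p a 3≤n lpf p≤r∸1)

  small-X : X < 4 → CoveringChain X Y
  small-X X<4 = assemble [] [] sv refl ([] , [] , []) ([] , [] , []) [] [] (λ ()) nothing no-large
    where
    sv : StartValue (jIndex X Y) 1
    sv = subst (λ j → StartValue j 1)
      (sym (n≤0⇒n≡0 (primePi-mono (≤-trans (m⊓n≤n Y (X / 2)) (s≤s⁻¹ (m<n*o⇒m/o<n {X} {2} {2} X<4))))))
      start-zero
    no-large : ∀ n → InA X Y n → 3 ≤ n → n ∈ [] ⊎ n ∈ []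
    no-large n a@(_ , (p , lpf , _) , _) 3≤n =
      contradiction (admissible⇒8≤X (lpf-admissible a 3≤n lpf)) (<⇒≱ (≤-trans X<4 (s≤s (s≤s (s≤s (s≤s z≤n))))))

  -- j = π(M) = π(r) with r = p_j the greatest prime ≤ M, and the chain must start at 2 p_{j-1}.
  large-X : 4 ≤ X → CoveringChain X Y
  large-X 4≤X = via (greatestPrime≤-exists (⊓-glb 2≤Y (*≤⇒≤/ 2 2 X 4≤X)))
    where
    via : ∃ (GreatestPrime≤ M) → CoveringChain X Y
    via (r , gr@(pr , r≤M , greatest-r)) with 3 ≤? r
    ... | no r≱3 = chain-below prime[2] (≤-trans (prime⇒≥2 pr) r≤M) sv
                     λ p adm → ≤-trans (greatest-r p (proj₁ adm) (admissible⇒≤M adm)) r≤2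
      where
      r≤2 : r ≤ 2
      r≤2 = s≤s⁻¹ (≰⇒> r≱3)
      sv : StartValue (jIndex X Y) (2 * 2)
      sv = subst (λ j → StartValue j 4)
        (sym (trans (sym (greatestPrime≤⇒primePi gr)) (cong primePi (≤-antisym r≤2 (prime⇒≥2 pr))))) start-one
    ... | yes 3≤r = below (greatestPrime≤-exists (∸-monoˡ-≤ 1 3≤r)) (primeInA? X Y r)
      where
      sv : ∀ {q} → GreatestPrime≤ (r ∸ 1) q → StartValue (jIndex X Y) (2 * q)
      sv {q} gq = subst (λ j → StartValue j (2 * q))
        (sym (trans (sym (greatestPrime≤⇒primePi gr)) (primePi-prime pr))) (greatestPrime≤⇒startValue gq)
      below : ∃ (GreatestPrime≤ (r ∸ 1)) → Dec (Admissible r) → CoveringChain X Y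
      below (q , gq) (yes adm-r) = chain-through gr adm-r 3≤r gq (sv gq)
      below (q , gq@(pq , q≤r∸1 , greatest-q)) (no ¬adm-r) =
        chain-below pq (≤-trans q≤r∸1 (≤-trans (m∸n≤m r 1) r≤M)) (sv gq) admissible≤q
        where
        admissible≤q : ∀ p → Admissible p → p ≤ q
        admissible≤q p adm with ≤⇒≡∨≤∸1 (greatest-r p (proj₁ adm) (admissible⇒≤M adm))
        ... | inj₁ refl = contradiction adm ¬adm-r
        ... | inj₂ p≤r∸1 = greatest-q p (proj₁ adm) p≤r∸1

  coveringChain : CoveringChain X Y
  coveringChain with 4 ≤? X
  ... | yes 4≤X = large-X 4≤X
  ... | no 4≰X = small-X (≰⇒> 4≰X)

coveringChain : ∀ X Y → 2 ≤ X → 2 ≤ Y → CoveringChain X Y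
coveringChain = <-rec (λ X → ∀ Y → 2 ≤ X → 2 ≤ Y → CoveringChain X Y)
  λ X ih Y 2≤X 2≤Y → InductionStep.coveringChain X Y 2≤X 2≤Y ih

proposition3p1 : (X Y : ℕ) → 2 ≤ X → 2 ≤ Y →
    ∃ λ (c : List ℕ) → Chain c × All (InS X Y) c ×
      (∃ λ b → StartValue (jIndex X Y) b × head c ≡ just b) × last c ≡ just 2 ×
      (∀ n → InA X Y n → n ∈ c)
proposition3p1 = coveringChain
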